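{- Let $T_v$ be a colored rooted ternary tree with root $v$ and root vector $\mathbf{v}$, such that $v$ has three children $u,w,z$ with $1\leq|T_u|\leq3$ and $1\leq|T_w|\leq 3$. (i) If $|T_z|=2$, there are $e_0,e_1,e_2,e_3\in\mathbb{N}$ such that $\mathbf{v}\geq\mathbf{e}=(\varphi^{e_s})_{s=0,\dots,3}$ and $\Psi(\mathbf{e})\geq 8$. (ii) If $|T_z|=3$, there are $e_0,e_1,e_2,e_3\in\mathbb{N}$ such that $\mathbf{v}\geq\mathbf{e}=(\varphi^{e_s})_{s=0,\dots,3}$ and $\Psi(\mathbf{e})\geq 10$.
   Context: For a vertex $x$, $T_x$ is the subtree of $x$ and its descendants and $|T_x|$ its number of vertices. $\varphi=(1+\sqrt5)/2$, $\mathbb{N}=\{0,1,2,\dots\}$, $\Psi(\mathbf{e})=2(e_1+e_2+e_3)$, and $\geq$ between vectors is componentwise. A colored rooted ternary tree is a rooted tree in which every vertex has at most three children, every non-root vertex $x$ has a label $l_x\in\{1,2,3\}$, and children of a common vertex have distinct labels. Its root vector is defined recursively; for a vertex $x$ let $\mathbf{x}=(x_0,x_1,x_2,x_3)$ denote the root vector of $T_x$. For the root $v$: Rule 0: no children gives $\mathbf{v}=(1,1,1,1)$. Rule 1: exactly one child $a$ gives $\mathbf{v}=(a_1,a_0+a_1,a_3,a_2)$, $(a_1,a_3,a_2,a_0+a_1)$ or $(a_1,a_2,a_0+a_1,a_3)$ according as $l_a=1,2,3$. Rule 2: for exactly two children named $a,b$ with $(l_a,l_b)\in\{(1,2),(2,3),(3,1)\}$: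 $\mathbf{v}=(a_1b_1,a_0b_2+a_1b_3,a_3b_2,a_2b_1+a_3b_0)$ if $l_a=1$; $(a_1b_1,a_3b_2,a_3b_0+a_2b_1,a_1b_3+a_0b_2)$ if $l_a=2$; $(a_1b_1,a_3b_0+a_2b_1,a_0b_2+a_1b_3,a_3b_2)$ if $l_a=3$. Rule 3: three children $a,b,c$ labeled $1,2,3$ give $\mathbf{v}=(a_0b_0c_0+a_1b_1c_1,a_0b_2c_3+a_1b_3c_2,a_2b_3c_0+a_3b_2c_1,a_2b_1c_3+a_3b_0c_2)$. -}

module Defs where

open import Data.Nat using (ℕ; zero; suc; _+_; _*_; _≤_)
open import Data.Integer as ℤ using (ℤ; +_)
open import Data.Maybe using (Maybe; just; nothing)
open import Data.Product using (_×_; _,_)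
open import Data.Sum using (_⊎_)

-- A vertex has (optionally) a child with label 1, with label 2 and with
-- label 3; this encodes "at most three children, non-root vertices carry
-- labels in {1,2,3}, siblings have distinct labels".

data Tree : Set where
  node : Maybe Tree → Maybe Tree → Maybe Tree → Tree

size : Tree → ℕ
sizeM : Maybe Tree → ℕ
size (node a b c) = suc (sizeM a + sizeM b + sizeM c)
sizeM nothing  = 0
sizeM (just t) = size t

record V4 : Set where
  constructor ⟨_,_,_,_⟩
  field
    c0 c1 c2 c3 : ℕ
open V4 public

rootVec : Tree → V4
rootVec (node nothing nothing nothing) = ⟨ 1 , 1 , 1 , 1 ⟩
rootVec (node (just ta) nothing nothing) with rootVec ta
... | ⟨ a0 , a1 , a2 , a3 ⟩ = ⟨ a1 , a0 + a1 , a3 , a2 ⟩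
rootVec (node nothing (just ta) nothing) with rootVec ta
... | ⟨ a0 , a1 , a2 , a3 ⟩ = ⟨ a1 , a3 , a2 , a0 + a1 ⟩
rootVec (node nothing nothing (just ta)) with rootVec ta
... | ⟨ a0 , a1 , a2 , a3 ⟩ = ⟨ a1 , a2 , a0 + a1 , a3 ⟩
rootVec (node (just ta) (just tb) nothing) with rootVec ta | rootVec tb
... | ⟨ a0 , a1 , a2 , a3 ⟩ | ⟨ b0 , b1 , b2 , b3 ⟩ =
  ⟨ a1 * b1 , a0 * b2 + a1 * b3 , a3 * b2 , a2 * b1 + a3 * b0 ⟩
rootVec (node nothing (just ta) (just tb)) with rootVec ta | rootVec tb
... | ⟨ a0 , a1 , a2 , a3 ⟩ | ⟨ b0 , b1 , b2 , b3 ⟩ =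
  ⟨ a1 * b1 , a3 * b2 , a3 * b0 + a2 * b1 , a1 * b3 + a0 * b2 ⟩
-- Rule 2, (l_a,l_b) = (3,1)
rootVec (node (just tb) nothing (just ta)) with rootVec ta | rootVec tb
... | ⟨ a0 , a1 , a2 , a3 ⟩ | ⟨ b0 , b1 , b2 , b3 ⟩ =
  ⟨ a1 * b1 , a3 * b0 + a2 * b1 , a0 * b2 + a1 * b3 , a3 * b2 ⟩
rootVec (node (just ta) (just tb) (just tc)) with rootVec ta | rootVec tb | rootVec tc
... | ⟨ a0 , a1 , a2 , a3 ⟩ | ⟨ b0 , b1 , b2 , b3 ⟩ | ⟨ d0 , d1 , d2 , d3 ⟩ =
  ⟨ a0 * b0 * d0 + a1 * b1 * d1
  , a0 * b2 * d3 + a1 * b3 * d2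
  , a2 * b3 * d0 + a3 * b2 * d1
  , a2 * b1 * d3 + a3 * b0 * d2 ⟩

-- Exact arithmetic in ℤ[φ], φ = (1+√5)/2.  The pair (a , b) denotes a + bφ.

record Zφ : Set where
  constructor _+_φ
  field
    re im : ℤ

-- φ^e, using φ² = φ + 1, so (a + bφ)φ = b + (a+b)φ
φ^ : ℕ → Zφ
φ^ zero = (+ 1) + (+ 0) φ
φ^ (suc e) with φ^ e
... | a + b φ = b + (a ℤ.+ b) φ

-- The real number a + bφ is ≥ 0.  Writing x = 2a + b we have
-- a + bφ = (x + b√5)/2, and x + b√5 ≥ 0 iff one of the following holds.
NonNeg : Zφ → Set
NonNeg (a + b φ) =
  let x = (+ 2) ℤ.* a ℤ.+ b in
  (ℤ.0ℤ ℤ.≤ x × ℤ.0ℤ ℤ.≤ b)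
  ⊎ (ℤ.0ℤ ℤ.≤ x × (b ℤ.< ℤ.0ℤ) × ((+ 5) ℤ.* b ℤ.* b ℤ.≤ x ℤ.* x))
  ⊎ ((x ℤ.< ℤ.0ℤ) × ℤ.0ℤ ℤ.≤ b × (x ℤ.* x ℤ.≤ (+ 5) ℤ.* b ℤ.* b))

φPowLe : ℕ → ℕ → Set
φPowLe e n = NonNeg ((+ n ℤ.- Zφ.re (φ^ e)) + (ℤ.- Zφ.im (φ^ e)) φ)

_≥φ^_ : V4 → V4 → Set
v ≥φ^ e = φPowLe (c0 e) (c0 v) × φPowLe (c1 e) (c1 v) × φPowLe (c2 e) (c2 v) × φPowLe (c3 e) (c3 v)

Ψ : V4 → ℕ
Ψ e = 2 * (c1 e + c2 e + c3 e)

Small : Tree → Set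
Small t = 1 ≤ size t × size t ≤ 3

-- There are only sixteen colored ternary trees with at most three vertices, so the root vectors
-- in question come from 16³ triples of subtrees and can be inspected one by one.  For each entry n
-- the largest e with φ^e ≤ n is found by exact arithmetic in ℤ[φ], and these exponents already
-- give Ψ(e) ≥ 2(m + 2), where m is the largest size of a subtree of the root.  Parts (i) and (ii)
-- are the cases m ≥ 2 and m ≥ 3.
module Submission where

open import Defs
open import Data.Nat using (ℕ; zero; suc; _+_; _*_; _≤_; _≤?_; _⊔_; s≤s; z≤n)
open import Data.Nat.Properties
  using (≤-trans; m≤m+n; m≤n+m; m≤m⊔n; m≤n⊔m; +-monoˡ-≤; *-monoʳ-≤)
open import Data.Integer as ℤ using (+_)
open import Data.Maybe using (Maybe; just; nothing; is-just; to-witness-T; _>>=_)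
open import Data.Bool using (T)
open import Data.List using (List; []; _∷_; map; filter; cartesianProductWith)
open import Data.List.Membership.Propositional using (_∈_)
open import Data.List.Membership.Propositional.Properties
  using (∈-map⁺; ∈-filter⁺; ∈-cartesianProductWith⁺)
open import Data.List.Relation.Unary.All using (All; all?; lookup)
open import Data.List.Relation.Unary.Any using (here; there)
open import Data.Product using (_×_; Σ; _,_)
open import Data.Sum using (_⊎_; inj₁; inj₂)
open import Function using (_$_)
open import Relation.Nullary using (Dec; yes; no)
open import Relation.Nullary.Decidable using (_×-dec_; _⊎-dec_; from-yes; dec⇒maybe; T?)
open import Relation.Binary.PropositionalEquality using (_≡_; refl)

nonNeg? : (z : Zφ) → Dec (NonNeg z)
nonNeg? (a + b φ) =
  let x = (+ 2) ℤ.* a ℤ.+ b in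
  (ℤ.0ℤ ℤ.≤? x ×-dec ℤ.0ℤ ℤ.≤? b)
  ⊎-dec (ℤ.0ℤ ℤ.≤? x ×-dec b ℤ.<? ℤ.0ℤ ×-dec (+ 5) ℤ.* b ℤ.* b ℤ.≤? x ℤ.* x)
  ⊎-dec (x ℤ.<? ℤ.0ℤ ×-dec ℤ.0ℤ ℤ.≤? b ×-dec x ℤ.* x ℤ.≤? (+ 5) ℤ.* b ℤ.* b)

φPowLe? : (e n : ℕ) → Dec (φPowLe e n)
φPowLe? e n = nonNeg? ((+ n ℤ.- Zφ.re (φ^ e)) + (ℤ.- Zφ.im (φ^ e)) φ)

climbExponent : (fuel e n : ℕ) → φPowLe e n → Σ ℕ λ e′ → φPowLe e′ n
climbExponent zero       e n φ^e≤n = e , φ^e≤n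
climbExponent (suc fuel) e n φ^e≤n with φPowLe? (suc e) n
... | yes φ^e+1≤n = climbExponent fuel (suc e) n φ^e+1≤n
... | no _        = e , φ^e≤n

-- Fuel n suffices since φ^e > e; soundness does not depend on it.
largestExponentBelow : (n : ℕ) → Maybe (Σ ℕ λ e → φPowLe e n)
largestExponentBelow n = do
  φ^0≤n ← dec⇒maybe (φPowLe? 0 n)
  just (climbExponent n 0 n φ^0≤n)

exponentsBelow : (v : V4) → Maybe (Σ V4 (v ≥φ^_))
exponentsBelow v = do
  e₀ , p₀ ← largestExponentBelow (c0 v)
  e₁ , p₁ ← largestExponentBelow (c1 v)
  e₂ , p₂ ← largestExponentBelow (c2 v)
  e₃ , p₃ ← largestExponentBelow (c3 v)
  just (⟨ e₀ , e₁ , e₂ , e₃ ⟩ , p₀ , p₁ , p₂ , p₃)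

BoundedBelow : ℕ → V4 → Set
BoundedBelow K v = Σ V4 λ e → v ≥φ^ e × K ≤ Ψ e

BoundedBelow-weaken : ∀ {K K′ v} → K′ ≤ K → BoundedBelow K v → BoundedBelow K′ v
BoundedBelow-weaken K′≤K (e , v≥e , K≤Ψe) = e , v≥e , ≤-trans K′≤K K≤Ψe

certifyBoundedBelow : (K : ℕ) (v : V4) → Maybe (BoundedBelow K v)
certifyBoundedBelow K v = do
  e , v≥e ← exponentsBelow v
  K≤Ψe ← dec⇒maybe (K ≤? Ψ e)
  just (e , v≥e , K≤Ψe)

subtreeChoices : List Tree → List (Maybe Tree)
subtreeChoices ts = nothing ∷ map just ts

treesUpTo : ℕ → List Tree
treesUpTo zero    = []
treesUpTo (suc n) =
  filter (λ t → size t ≤? suc n)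
    (cartesianProductWith _$_ (cartesianProductWith node choices choices) choices)
  where choices = subtreeChoices (treesUpTo n)

mutual
  treesUpTo-complete : ∀ {n} t → size t ≤ n → t ∈ treesUpTo n
  treesUpTo-complete {suc n} t@(node x y z) (s≤s xyz≤n) =
    ∈-filter⁺ (λ t → size t ≤? suc n)
      (∈-cartesianProductWith⁺ _$_
        (∈-cartesianProductWith⁺ node
          (subtreeChoices-complete x
            (≤-trans (≤-trans (m≤m+n (sizeM x) (sizeM y)) (m≤m+n _ (sizeM z))) xyz≤n))
          (subtreeChoices-complete y
            (≤-trans (≤-trans (m≤n+m (sizeM y) (sizeM x)) (m≤m+n _ (sizeM z))) xyz≤n)))
        (subtreeChoices-complete z (≤-trans (m≤n+m (sizeM z) (sizeM x + sizeM y)) xyz≤n)))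
      (s≤s xyz≤n)

  subtreeChoices-complete : ∀ {n} x → sizeM x ≤ n → x ∈ subtreeChoices (treesUpTo n)
  subtreeChoices-complete nothing  _   = here refl
  subtreeChoices-complete (just t) t≤n = there (∈-map⁺ just (treesUpTo-complete t t≤n))

rootVec₃ : Tree → Tree → Tree → V4
rootVec₃ a b c = rootVec (node (just a) (just b) (just c))

largestSubtree : Tree → Tree → Tree → ℕ
largestSubtree a b c = size a ⊔ size b ⊔ size c

Certified : Tree → Tree → Tree → Set
Certified a b c =
  T (is-just (certifyBoundedBelow (2 * (largestSubtree a b c + 2)) (rootVec₃ a b c)))

certified? : ∀ a b c → Dec (Certified a b c)
certified? a b c = T? _

smallTriples-certified :
  All (λ a → All (λ b → All (Certified a b) (treesUpTo 3)) (treesUpTo 3)) (treesUpTo 3)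
smallTriples-certified =
  from-yes (all? (λ a → all? (λ b → all? (certified? a b) small) small) small)
  where small = treesUpTo 3

rootVec₃-boundedBelow : ∀ {m} a b c → size a ≤ 3 → size b ≤ 3 → size c ≤ 3 →
  m ≤ largestSubtree a b c → BoundedBelow (2 * (m + 2)) (rootVec₃ a b c)
rootVec₃-boundedBelow a b c a≤3 b≤3 c≤3 m≤largest =
  BoundedBelow-weaken (*-monoʳ-≤ 2 (+-monoˡ-≤ 2 m≤largest)) $
    to-witness-T _ (lookup (lookup (lookup smallTriples-certified (treesUpTo-complete a a≤3))
                                   (treesUpTo-complete b b≤3))
                           (treesUpTo-complete c c≤3))

SomeSubtreeOfSize : ℕ → Tree → Tree → Tree → Set
SomeSubtreeOfSize k a b c =
    (Small a × Small b × size c ≡ k)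
  ⊎ (Small a × size b ≡ k × Small c)
  ⊎ (size a ≡ k × Small b × Small c)

rootVec₃-boundedBelow-size : ∀ {k} a b c → k ≤ 3 → SomeSubtreeOfSize k a b c →
  BoundedBelow (2 * (k + 2)) (rootVec₃ a b c)
rootVec₃-boundedBelow-size a b c c≤3 (inj₁ ((_ , a≤3) , (_ , b≤3) , refl)) =
  rootVec₃-boundedBelow a b c a≤3 b≤3 c≤3 (m≤n⊔m (size a ⊔ size b) (size c))
rootVec₃-boundedBelow-size a b c b≤3 (inj₂ (inj₁ ((_ , a≤3) , refl , (_ , c≤3)))) =
  rootVec₃-boundedBelow a b c a≤3 b≤3 c≤3
    (≤-trans (m≤n⊔m (size a) (size b)) (m≤m⊔n (size a ⊔ size b) (size c)))
rootVec₃-boundedBelow-size a b c a≤3 (inj₂ (inj₂ (refl , (_ , b≤3) , (_ , c≤3)))) =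
  rootVec₃-boundedBelow a b c a≤3 b≤3 c≤3
    (≤-trans (m≤m⊔n (size a) (size b)) (m≤m⊔n (size a ⊔ size b) (size c)))

proposition16 : (a b c : Tree)
    → ((Small a × Small b × size c ≡ 2)
        ⊎ (Small a × size b ≡ 2 × Small c)
        ⊎ (size a ≡ 2 × Small b × Small c)
        → Σ V4 λ e → rootVec (node (just a) (just b) (just c)) ≥φ^ e × 8 ≤ Ψ e)
      × ((Small a × Small b × size c ≡ 3)
        ⊎ (Small a × size b ≡ 3 × Small c)
        ⊎ (size a ≡ 3 × Small b × Small c)
        → Σ V4 λ e → rootVec (node (just a) (just b) (just c)) ≥φ^ e × 10 ≤ Ψ e)
proposition16 a b c =
  rootVec₃-boundedBelow-size a b c (s≤s (s≤s z≤n)) ,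
  rootVec₃-boundedBelow-size a b c (s≤s (s≤s (s≤s z≤n)))
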